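{- Let $n$ be even and $m\ge1$, and let $P=\bigoplus_{i=1}^n\mathbf{m}$. The signed cardinality statistic $SC$ is homomesic (with orbit average $0$) under rowmotion on $\mathcal{IC}(P)$.
   Context: $\mathbf{m}$ is an antichain poset with $m$ elements and $\bigoplus_{i=1}^n\mathbf{m}$ is the ordinal sum of $n$ copies (every element of the $i$-th copy lies below every element of the $j$-th copy for $i<j$; elements within a copy are incomparable). This poset is ranked, elements of the $i$-th copy having rank $i-1$. For $x\in P$, $SC(x)=1$ if the rank of $x$ is even and $-1$ if odd; $SC(I)=\sum_{x\in I}SC(x)$. A subset $I$ is interval-closed if whenever $x,y\in I$ and $x\le z\le y$, then $z\in I$; $\mathcal{IC}(P)$ is the set of interval-closed subsets. The toggle $t_x$ sends $I$ to $I\triangle\{x\}$ if this set is interval-closed, and to $I$ otherwise; rowmotion is $t_{x_1}\circ\cdots\circ t_{x_N}$ for a linear extension $(x_1,\dots,x_N)$ (independent of the choice). A statistic is homomesic if its average over each rowmotion orbit is the same for all orbits. -}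

module Defs where

open import Data.Bool using (Bool; true; false; not; if_then_else_)
open import Data.Nat using (ℕ; zero; suc; _%_)
open import Data.Fin using (Fin; toℕ; _<_; _≟_)
open import Data.Fin.Properties using (all?; _<?_)
open import Data.Fin.Properties as FinP using ()
open import Data.Integer using (ℤ; +_; -_; _+_)
open import Data.List using (List; []; _∷_; foldr; concatMap; map; allFin; upTo)
open import Data.Product using (_×_; _,_)
open import Data.Sum using (_⊎_)
open import Data.Vec using (Vec; lookup; _[_]%=_)
open import Relation.Binary.PropositionalEquality using (_≡_)
open import Relation.Nullary using (Dec; yes; no; does)
open import Relation.Nullary.Decidable using (_×-dec_; _→-dec_; _⊎-dec_)
open import Data.Bool.Properties as BoolP using ()

-- Elements of P = ⊕_{i=1}^n m : pairs (i , a), i = copy index (0-based), a = element of the antichain.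
Elem : ℕ → ℕ → Set
Elem n m = Fin n × Fin m

_≤P_ : ∀ {n m} → Elem n m → Elem n m → Set
(i , a) ≤P (j , b) = (i < j) ⊎ ((i ≡ j) × (a ≡ b))

_≤P?_ : ∀ {n m} (x y : Elem n m) → Dec (x ≤P y)
(i , a) ≤P? (j , b) = (i <? j) ⊎-dec ((i ≟ j) ×-dec (a ≟ b))

Subset : ℕ → ℕ → Set
Subset n m = Vec (Vec Bool m) n

_∈S_ : ∀ {n m} → Elem n m → Subset n m → Set
(i , a) ∈S S = lookup (lookup S i) a ≡ true

IntervalClosed : ∀ {n m} → Subset n m → Set
IntervalClosed {n} {m} S =
  ∀ (x y z : Elem n m) → x ∈S S → y ∈S S → x ≤P z → z ≤P y → z ∈S S

allE? : ∀ {n m} {P : Elem n m → Set} → (∀ x → Dec (P x)) → Dec (∀ x → P x)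
allE? {P = P} P? with all? (λ i → all? (λ a → P? (i , a)))
... | yes h = yes (λ { (i , a) → h i a })
... | no ¬h = no (λ h → ¬h (λ i a → h (i , a)))

intervalClosed? : ∀ {n m} (S : Subset n m) → Dec (IntervalClosed S)
intervalClosed? S =
  allE? λ x → allE? λ y → allE? λ z →
    (lookup (lookup S (Data.Product.proj₁ x)) (Data.Product.proj₂ x) BoolP.≟ true) →-dec
    ((lookup (lookup S (Data.Product.proj₁ y)) (Data.Product.proj₂ y) BoolP.≟ true) →-dec
    ((x ≤P? z) →-dec ((z ≤P? y) →-dec
    (lookup (lookup S (Data.Product.proj₁ z)) (Data.Product.proj₂ z) BoolP.≟ true))))

flipAt : ∀ {n m} → Elem n m → Subset n m → Subset n m
flipAt (i , a) S = S [ i ]%= (λ row → row [ a ]%= not)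

toggle : ∀ {n m} → Elem n m → Subset n m → Subset n m
toggle x S with intervalClosed? (flipAt x S)
... | yes _ = flipAt x S
... | no _  = S

-- A linear extension (x_1, ..., x_N): copy 0 first, then copy 1, etc.
linExt : (n m : ℕ) → List (Elem n m)
linExt n m = concatMap (λ i → map (λ a → (i , a)) (allFin m)) (allFin n)

-- rowmotion = t_{x_1} ∘ ... ∘ t_{x_N}  (t_{x_N} applied first)
rowmotion : ∀ {n m} → Subset n m → Subset n m
rowmotion {n} {m} S = foldr toggle S (linExt n m)

iter : ∀ {A : Set} → ℕ → (A → A) → A → A
iter zero    f x = x
iter (suc k) f x = f (iter k f x)

-- SC(x): +1 if rank (= copy index, 0-based) is even, -1 if odd
SCelem : ∀ {n m} → Elem n m → ℤ
SCelem (i , a) with toℕ i % 2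
... | zero  = + 1
... | suc _ = - (+ 1)

sumℤ : List ℤ → ℤ
sumℤ = foldr _+_ (+ 0)

SC : ∀ {n m} → Subset n m → ℤ
SC {n} {m} S =
  sumℤ (map (λ { (i , a) → if lookup (lookup S i) a then SCelem (i , a) else + 0 }) (linExt n m))

orbitSum : ∀ {n m} → ℕ → Subset n m → ℤ
orbitSum p I = sumℤ (map (λ k → SC (iter k rowmotion I)) (upTo p))

-- Rowmotion toggles the rows from the top down, so row j is toggled while the rows below
-- it still belong to I and those above it already belong to row(I).  If some row below and
-- some row above are nonempty, row j is full and stays full; otherwise, if the rest of the
-- set is closed on both sides of j, every toggle succeeds and row j is complemented; and
-- otherwise row j is empty and stays empty.  So row j adds 2m, m or 0 times its sign to
-- SC(I) + SC(row(I)).  Summed over the rows from d upwards this is m times sign d, m times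
-- the sum of sign i over d ≤ i < n, or 0, according as the cut at d is straddled, closed
-- or open; evenness of n gives this at d = n, and at d = 0 it is 0.  Hence
-- SC(row(I)) = - SC(I), so every orbit sum equals its own negative.
module Submission where

open import Defs
open import Data.Nat using (ℕ; _≤_; _<_)
open import Data.Nat.Divisibility using (_∣_)
open import Data.Integer using (+_)
open import Relation.Binary.PropositionalEquality using (_≡_; _≢_)

open import Data.Bool using (Bool; true; false; not; if_then_else_)
import Data.Bool.Properties as BoolP
open import Data.Fin as F using (Fin; toℕ)
import Data.Fin.Properties as FinP
open import Data.Integer using (ℤ; -_; _*_; -[1+_]) renaming (_+_ to _⊕_)
import Data.Integer.Properties as ℤP
open import Algebra.Properties.AbelianGroup ℤP.+-0-abelianGroup using (inverseʳ-unique; ∙-cancelˡ)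
open import Data.Integer.Tactic.RingSolver using (solve-∀)
open import Data.List using (List; []; _∷_; _++_; foldr; map; concatMap; allFin; tabulate; applyUpTo)
import Data.List.Properties as ListP
open import Data.List.Membership.Propositional using (_∈_)
open import Data.List.Membership.Propositional.Properties using (∈-allFin)
open import Data.List.Relation.Unary.All as All using (All; []; _∷_)
open import Data.List.Relation.Unary.All.Properties using (tabulate⁺)
open import Data.List.Relation.Unary.Any using (here; there)
open import Data.List.Relation.Unary.Unique.Propositional using (Unique; _∷_)
open import Data.List.Relation.Unary.Unique.Propositional.Properties using (allFin⁺)
open import Data.Nat as ℕ using (zero; suc)
import Data.Nat.Properties as ℕP
open import Data.Nat.Divisibility using (divides)
open import Data.Nat.DivMod using (m%n<n)
open import Data.Product using (∃; _×_; _,_)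
open import Data.Sum using (_⊎_; inj₁; inj₂)
open import Data.Vec using (lookup)
import Data.Vec.Properties as VecP
open import Function using (_∘_; id)
open import Relation.Nullary using (¬_; Dec; yes; no; contradiction)
open import Relation.Nullary.Decidable using (_×-dec_; _→-dec_)
open import Relation.Binary.PropositionalEquality
  using (refl; sym; trans; cong; cong₂; subst; ≢-sym; module ≡-Reasoning)

private variable
  n m : ℕ
  d : ℕ
  i j : Fin n
  a b : Fin m
  S T U : Subset n m
  w : ℤ

-- Opaque, so that S and i can be inferred from member S i a.
opaque
  member : Subset n m → Fin n → Fin m → Bool
  member S i a = lookup (lookup S i) a

RowNonEmpty : Subset n m → Fin n → Set
RowNonEmpty S i = ∃ λ a → member S i a ≡ true

RowFull : Subset n m → Fin n → Set
RowFull S i = ∀ a → member S i a ≡ true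

rowNonEmpty? : (S : Subset n m) (i : Fin n) → Dec (RowNonEmpty S i)
rowNonEmpty? S i = FinP.any? λ a → member S i a BoolP.≟ true

rowFull? : (S : Subset n m) (i : Fin n) → Dec (RowFull S i)
rowFull? S i = FinP.all? λ a → member S i a BoolP.≟ true

¬rowNonEmpty⇒false : ¬ RowNonEmpty S i → member S i a ≡ false
¬rowNonEmpty⇒false {S = S} {i} {a} empty with member S i a in eq
... | true  = contradiction (a , eq) empty
... | false = refl

RowsClosed : Subset n m → Set
RowsClosed {n} S = ∀ (i k l : Fin n) → toℕ i < toℕ k → toℕ k < toℕ l →
  RowNonEmpty S i → RowNonEmpty S l → RowFull S k

opaque
  unfolding member

  intervalClosed⇒rowsClosed : IntervalClosed S → RowsClosed S
  intervalClosed⇒rowsClosed ic i k l i<k k<l (a , ia) (b , lb) c =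
    ic (i , a) (l , b) (k , c) ia lb (inj₁ i<k) (inj₁ k<l)

  rowsClosed⇒intervalClosed : RowsClosed S → IntervalClosed S
  rowsClosed⇒intervalClosed rc x y z x∈ y∈ (inj₂ (refl , refl)) _ = x∈
  rowsClosed⇒intervalClosed rc x y z x∈ y∈ (inj₁ _) (inj₂ (refl , refl)) = y∈
  rowsClosed⇒intervalClosed rc (i , a) (l , b) (k , c) x∈ y∈ (inj₁ i<k) (inj₁ k<l) =
    rc i k l i<k k<l (a , x∈) (b , y∈) c

toggle-accepts : (x : Elem n m) (S : Subset n m) → IntervalClosed (flipAt x S) → toggle x S ≡ flipAt x S
toggle-accepts x S ic with intervalClosed? (flipAt x S)
... | yes _  = refl
... | no ¬ic = contradiction ic ¬ic

toggle-rejects : (x : Elem n m) (S : Subset n m) → ¬ IntervalClosed (flipAt x S) → toggle x S ≡ S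
toggle-rejects x S ¬ic with intervalClosed? (flipAt x S)
... | yes ic = contradiction ic ¬ic
... | no _   = refl

toggle-preserves-intervalClosed : (x : Elem n m) (S : Subset n m) →
                                  IntervalClosed S → IntervalClosed (toggle x S)
toggle-preserves-intervalClosed x S ic with intervalClosed? (flipAt x S)
... | yes ic′ = ic′
... | no _    = ic

foldr-preserves : ∀ {A B : Set} (P : B → Set) (f : A → B → B) → (∀ x {y} → P y → P (f x y)) →
                  ∀ {e} → P e → ∀ xs → P (foldr f e xs)
foldr-preserves P f pres Pe []       = Pe
foldr-preserves P f pres Pe (x ∷ xs) = pres x (foldr-preserves P f pres Pe xs)

toggles-preserve-intervalClosed : (xs : List (Elem n m)) (S : Subset n m) →
                                  IntervalClosed S → IntervalClosed (foldr toggle S xs)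
toggles-preserve-intervalClosed xs S ic =
  foldr-preserves IntervalClosed toggle (λ x {T} → toggle-preserves-intervalClosed x T) ic xs

opaque
  unfolding member

  member-flipAt : (S : Subset n m) → member (flipAt (j , a) S) j a ≡ not (member S j a)
  member-flipAt {j = j} {a} S =
    trans (cong (λ row → lookup row a) (VecP.lookup∘updateAt j S))
          (VecP.lookup∘updateAt a (lookup S j))

  member-flipAt-otherColumn : (S : Subset n m) → b ≢ a → member (flipAt (j , a) S) j b ≡ member S j b
  member-flipAt-otherColumn {b = b} {a} {j} S b≢a =
    trans (cong (λ row → lookup row b) (VecP.lookup∘updateAt j S))
          (VecP.lookup∘updateAt′ b a b≢a (lookup S j))

record AgreeOff (j : Fin n) (T S : Subset n m) : Set where
  constructor agreeOff
  field rowEq : ∀ i → i ≢ j → lookup T i ≡ lookup S i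
open AgreeOff

agreeOff-refl : AgreeOff j S S
agreeOff-refl = agreeOff λ _ _ → refl

agreeOff-sym : AgreeOff j T S → AgreeOff j S T
agreeOff-sym o = agreeOff λ i i≢j → sym (rowEq o i i≢j)

agreeOff-trans : AgreeOff j T U → AgreeOff j U S → AgreeOff j T S
agreeOff-trans o o′ = agreeOff λ i i≢j → trans (rowEq o i i≢j) (rowEq o′ i i≢j)

flipAt-agreeOff : (S : Subset n m) → AgreeOff j (flipAt (j , a) S) S
flipAt-agreeOff {j = j} S = agreeOff λ i i≢j → VecP.lookup∘updateAt′ i j i≢j S

toggle-agreeOff : (S : Subset n m) → AgreeOff j (toggle (j , a) S) S
toggle-agreeOff {j = j} {a} S with intervalClosed? (flipAt (j , a) S)
... | yes _ = flipAt-agreeOff S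
... | no _  = agreeOff-refl

opaque
  unfolding member

  agreeOff-member : AgreeOff j T S → i ≢ j → member T i a ≡ member S i a
  agreeOff-member {a = a} o i≢j = cong (λ row → lookup row a) (rowEq o _ i≢j)

agreeOff-nonEmpty : AgreeOff j T S → i ≢ j → RowNonEmpty S i → RowNonEmpty T i
agreeOff-nonEmpty o i≢j (a , p) = a , trans (agreeOff-member o i≢j) p

agreeOff-full : AgreeOff j T S → i ≢ j → RowFull S i → RowFull T i
agreeOff-full o i≢j full a = trans (agreeOff-member o i≢j) (full a)

>⇒≢ : toℕ j < toℕ i → i ≢ j
>⇒≢ lt = ≢-sym (FinP.<⇒≢ lt)

-- Cuts: the rows below d and the rows from d upwards

NonEmptyBelow : ℕ → Subset n m → Set
NonEmptyBelow {n} d S = ∃ λ (i : Fin n) → toℕ i < d × RowNonEmpty S i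

ClosedBelow : ℕ → Subset n m → Set
ClosedBelow {n} d S = ∀ (i k : Fin n) → toℕ i < toℕ k → toℕ k < d →
  RowNonEmpty S i → RowFull S k

NonEmptyFrom : ℕ → Subset n m → Set
NonEmptyFrom {n} d S = ∃ λ (l : Fin n) → d ≤ toℕ l × RowNonEmpty S l

ClosedFrom : ℕ → Subset n m → Set
ClosedFrom {n} d S = ∀ (k l : Fin n) → d ≤ toℕ k → toℕ k < toℕ l →
  RowNonEmpty S l → RowFull S k

nonEmptyBelow? : ∀ d (S : Subset n m) → Dec (NonEmptyBelow d S)
nonEmptyBelow? d S = FinP.any? λ i → (toℕ i ℕ.<? d) ×-dec rowNonEmpty? S i

nonEmptyFrom? : ∀ d (S : Subset n m) → Dec (NonEmptyFrom d S)
nonEmptyFrom? d S = FinP.any? λ l → (d ℕ.≤? toℕ l) ×-dec rowNonEmpty? S l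

closedBelow? : ∀ d (S : Subset n m) → Dec (ClosedBelow d S)
closedBelow? d S = FinP.all? λ i → FinP.all? λ k →
  (toℕ i ℕ.<? toℕ k) →-dec ((toℕ k ℕ.<? d) →-dec (rowNonEmpty? S i →-dec rowFull? S k))

closedFrom? : ∀ d (S : Subset n m) → Dec (ClosedFrom d S)
closedFrom? d S = FinP.all? λ k → FinP.all? λ l →
  (d ℕ.≤? toℕ k) →-dec ((toℕ k ℕ.<? toℕ l) →-dec (rowNonEmpty? S l →-dec rowFull? S k))

nonEmptyBelow-suc⁺ : NonEmptyBelow d S → NonEmptyBelow (suc d) S
nonEmptyBelow-suc⁺ (i , i<d , ne) = i , ℕP.m<n⇒m<1+n i<d , ne

nonEmptyBelow-row : RowNonEmpty S j → NonEmptyBelow (suc (toℕ j)) S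
nonEmptyBelow-row {j = j} ne = j , ℕP.n<1+n (toℕ j) , ne

nonEmptyBelow-suc⁻ : NonEmptyBelow (suc (toℕ j)) S → NonEmptyBelow (toℕ j) S ⊎ RowNonEmpty S j
nonEmptyBelow-suc⁻ (i , i≤j , ne) with ℕP.m<1+n⇒m<n∨m≡n i≤j
... | inj₁ i<j = inj₁ (i , i<j , ne)
... | inj₂ i≡j rewrite FinP.toℕ-injective i≡j = inj₂ ne

nonEmptyFrom-suc⁺ : NonEmptyFrom (suc d) S → NonEmptyFrom d S
nonEmptyFrom-suc⁺ (l , d<l , ne) = l , ℕP.<⇒≤ d<l , ne

nonEmptyFrom-row : RowNonEmpty S j → NonEmptyFrom (toℕ j) S
nonEmptyFrom-row {j = j} ne = j , ℕP.≤-refl , ne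

nonEmptyFrom-suc⁻ : NonEmptyFrom (toℕ j) S → NonEmptyFrom (suc (toℕ j)) S ⊎ RowNonEmpty S j
nonEmptyFrom-suc⁻ (l , j≤l , ne) with ℕP.m≤n⇒m<n∨m≡n j≤l
... | inj₁ j<l = inj₁ (l , j<l , ne)
... | inj₂ j≡l rewrite FinP.toℕ-injective j≡l = inj₂ ne

closedBelow-suc⁻ : ClosedBelow (suc d) S → ClosedBelow d S
closedBelow-suc⁻ cb i k i<k k<d = cb i k i<k (ℕP.m<n⇒m<1+n k<d)

closedBelow-row : ClosedBelow (suc (toℕ j)) S → NonEmptyBelow (toℕ j) S → RowFull S j
closedBelow-row {j = j} cb (i , i<j , ne) = cb i j i<j (ℕP.n<1+n (toℕ j)) ne

closedBelow-suc⁺ : ClosedBelow (toℕ j) S → (NonEmptyBelow (toℕ j) S → RowFull S j) →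
                   ClosedBelow (suc (toℕ j)) S
closedBelow-suc⁺ cb full i k i<k k≤j ne with ℕP.m<1+n⇒m<n∨m≡n k≤j
... | inj₁ k<j = cb i k i<k k<j ne
... | inj₂ k≡j rewrite FinP.toℕ-injective k≡j = full (i , i<k , ne)

closedFrom-suc⁻ : ClosedFrom d S → ClosedFrom (suc d) S
closedFrom-suc⁻ cf k l d<k = cf k l (ℕP.<⇒≤ d<k)

closedFrom-row : ClosedFrom (toℕ j) S → NonEmptyFrom (suc (toℕ j)) S → RowFull S j
closedFrom-row {j = j} cf (l , j<l , ne) = cf j l ℕP.≤-refl j<l ne

closedFrom-suc⁺ : ClosedFrom (suc (toℕ j)) S → (NonEmptyFrom (suc (toℕ j)) S → RowFull S j) →
                  ClosedFrom (toℕ j) S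
closedFrom-suc⁺ cf full k l j≤k k<l ne with ℕP.m≤n⇒m<n∨m≡n j≤k
... | inj₁ j<k = cf k l j<k k<l ne
... | inj₂ j≡k rewrite FinP.toℕ-injective j≡k = full (l , k<l , ne)

rowsClosed-closedBelow : RowsClosed S → NonEmptyFrom d S → ClosedBelow d S
rowsClosed-closedBelow rc (l , d≤l , nel) i k i<k k<d nei =
  rc i k l i<k (ℕP.<-≤-trans k<d d≤l) nei nel

rowsClosed-closedFrom : RowsClosed S → NonEmptyBelow d S → ClosedFrom d S
rowsClosed-closedFrom rc (i , i<d , nei) k l d≤k k<l nel =
  rc i k l (ℕP.<-≤-trans i<d d≤k) k<l nei nel

module _ (o : AgreeOff j T S) where

  agreeOff-nonEmptyBelow : NonEmptyBelow (toℕ j) S → NonEmptyBelow (toℕ j) T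
  agreeOff-nonEmptyBelow (i , i<j , ne) = i , i<j , agreeOff-nonEmpty o (FinP.<⇒≢ i<j) ne

  agreeOff-closedBelow : ClosedBelow (toℕ j) S → ClosedBelow (toℕ j) T
  agreeOff-closedBelow cb i k i<k k<j ne =
    agreeOff-full o (FinP.<⇒≢ k<j)
      (cb i k i<k k<j (agreeOff-nonEmpty (agreeOff-sym o) (FinP.<⇒≢ (ℕP.<-trans i<k k<j)) ne))

  agreeOff-nonEmptyFrom : NonEmptyFrom (suc (toℕ j)) S → NonEmptyFrom (suc (toℕ j)) T
  agreeOff-nonEmptyFrom (l , j<l , ne) = l , j<l , agreeOff-nonEmpty o (>⇒≢ j<l) ne

  agreeOff-closedFrom : ClosedFrom (suc (toℕ j)) S → ClosedFrom (suc (toℕ j)) T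
  agreeOff-closedFrom cf k l j<k k<l ne =
    agreeOff-full o (>⇒≢ j<k)
      (cf k l j<k k<l (agreeOff-nonEmpty (agreeOff-sym o) (>⇒≢ (ℕP.<-trans j<k k<l)) ne))

rowsClosed-changeRow : RowsClosed S → AgreeOff j T S →
  ¬ (NonEmptyBelow (toℕ j) S × NonEmptyFrom (suc (toℕ j)) S) →
  ClosedBelow (toℕ j) S → ClosedFrom (suc (toℕ j)) S → RowsClosed T
rowsClosed-changeRow {j = j} rc o unflanked cb cf i k l i<k k<l nei nel
  with i F.≟ j | k F.≟ j | l F.≟ j
... | _        | yes refl | _        =
  contradiction ((i , i<k , agreeOff-nonEmpty (agreeOff-sym o) (FinP.<⇒≢ i<k) nei)
               , (l , k<l , agreeOff-nonEmpty (agreeOff-sym o) (>⇒≢ k<l) nel)) unflanked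
... | yes refl | no k≢j   | _        =
  agreeOff-full o k≢j (cf k l i<k k<l (agreeOff-nonEmpty (agreeOff-sym o) (>⇒≢ (ℕP.<-trans i<k k<l)) nel))
... | no i≢j   | no k≢j   | yes refl =
  agreeOff-full o k≢j (cb i k i<k k<l (agreeOff-nonEmpty (agreeOff-sym o) i≢j nei))
... | no i≢j   | no k≢j   | no l≢j   =
  agreeOff-full o k≢j (rc i k l i<k k<l (agreeOff-nonEmpty (agreeOff-sym o) i≢j nei)
                                        (agreeOff-nonEmpty (agreeOff-sym o) l≢j nel))

-- Toggling one row

toggleColumns : Fin n → List (Fin m) → Subset n m → Subset n m
toggleColumns j as S = foldr toggle S (map (j ,_) as)

toggleRow : Fin n → Subset n m → Subset n m
toggleRow {m = m} j = toggleColumns j (allFin m)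

flipColumns : Fin n → List (Fin m) → Subset n m → Subset n m
flipColumns j as S = foldr flipAt S (map (j ,_) as)

toggleColumns-agreeOff : ∀ as (S : Subset n m) → AgreeOff j (toggleColumns j as S) S
toggleColumns-agreeOff []       S = agreeOff-refl
toggleColumns-agreeOff (a ∷ as) S =
  agreeOff-trans (toggle-agreeOff (toggleColumns _ as S)) (toggleColumns-agreeOff as S)

flipColumns-agreeOff : ∀ as (S : Subset n m) → AgreeOff j (flipColumns j as S) S
flipColumns-agreeOff []       S = agreeOff-refl
flipColumns-agreeOff (a ∷ as) S =
  agreeOff-trans (flipAt-agreeOff (flipColumns _ as S)) (flipColumns-agreeOff as S)

member-flipColumns-∉ : ∀ (S : Subset n m) {as} → All (_≢ b) as →
                       member (flipColumns j as S) j b ≡ member S j b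
member-flipColumns-∉ S []                          = refl
member-flipColumns-∉ {j = j} S {a ∷ as} (a≢b ∷ rest) =
  trans (member-flipAt-otherColumn (flipColumns j as S) (≢-sym a≢b)) (member-flipColumns-∉ S rest)

member-flipColumns-∈ : ∀ (S : Subset n m) {as} → Unique as → b ∈ as →
                       member (flipColumns j as S) j b ≡ not (member S j b)
member-flipColumns-∈ {j = j} S {b ∷ as} (b≢ ∷ _) (here refl) =
  trans (member-flipAt (flipColumns j as S)) (cong not (member-flipColumns-∉ S (All.map ≢-sym b≢)))
member-flipColumns-∈ {j = j} S {a ∷ as} (a≢ ∷ u) (there b∈) =
  trans (member-flipAt-otherColumn (flipColumns j as S) (≢-sym (All.lookup a≢ b∈)))
        (member-flipColumns-∈ S u b∈)

flipAt-breaks-full : RowFull S j → ¬ RowFull (flipAt (j , a) S) j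
flipAt-breaks-full {S = S} {j} {a} full full′ =
  contradiction (trans (sym (cong not (full a))) (trans (sym (member-flipAt {j = j} S)) (full′ a))) λ ()

flipAt-fills-empty : ¬ RowNonEmpty S j → RowNonEmpty (flipAt (j , a) S) j
flipAt-fills-empty {S = S} {j} {a} empty =
  a , trans (member-flipAt S) (cong not (¬rowNonEmpty⇒false {S = S} {j} empty))

toggleColumns-flanked : RowsClosed S →
  NonEmptyBelow (toℕ j) S → NonEmptyFrom (suc (toℕ j)) S → ∀ as → toggleColumns j as S ≡ S
toggleColumns-flanked rc below above []       = refl
toggleColumns-flanked {S = S} {j} rc below@(i , i<j , nei) above@(l , j<l , nel) (a ∷ as)
  = trans (cong (toggle (j , a)) (toggleColumns-flanked rc below above as)) (toggle-rejects (j , a) S stuck)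
  where
  stuck : ¬ IntervalClosed (flipAt (j , a) S)
  stuck ic = flipAt-breaks-full {S = S} {j} {a} (rc i j l i<j j<l nei nel)
    (intervalClosed⇒rowsClosed ic i j l i<j j<l
      (agreeOff-nonEmpty (flipAt-agreeOff S) (FinP.<⇒≢ i<j) nei)
      (agreeOff-nonEmpty (flipAt-agreeOff S) (>⇒≢ j<l) nel))

rowsClosed-nonEmptyRow : RowsClosed S → RowNonEmpty S j →
  ClosedBelow (toℕ j) S × ClosedFrom (suc (toℕ j)) S
rowsClosed-nonEmptyRow rc ne =
  rowsClosed-closedBelow rc (nonEmptyFrom-row ne) , rowsClosed-closedFrom rc (nonEmptyBelow-row ne)

toggleColumns-unclosed : RowsClosed S →
  ¬ (ClosedBelow (toℕ j) S × ClosedFrom (suc (toℕ j)) S) → ∀ as → toggleColumns j as S ≡ S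
toggleColumns-unclosed rc unclosed []       = refl
toggleColumns-unclosed {S = S} {j} rc unclosed (a ∷ as) =
  trans (cong (toggle (j , a)) (toggleColumns-unclosed rc unclosed as)) (toggle-rejects (j , a) S stuck)
  where
  stuck : ¬ IntervalClosed (flipAt (j , a) S)
  stuck ic with rowsClosed-nonEmptyRow (intervalClosed⇒rowsClosed ic)
                  (flipAt-fills-empty {S = S} {j} {a} (unclosed ∘ rowsClosed-nonEmptyRow rc))
  ... | cb , cf = unclosed ( agreeOff-closedBelow (agreeOff-sym (flipAt-agreeOff S)) cb
                           , agreeOff-closedFrom (agreeOff-sym (flipAt-agreeOff S)) cf)

toggleColumns-unflanked : RowsClosed S →
  ¬ (NonEmptyBelow (toℕ j) S × NonEmptyFrom (suc (toℕ j)) S) →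
  ClosedBelow (toℕ j) S → ClosedFrom (suc (toℕ j)) S →
  ∀ as → toggleColumns j as S ≡ flipColumns j as S
toggleColumns-unflanked rc unflanked cb cf []       = refl
toggleColumns-unflanked {S = S} {j} rc unflanked cb cf (a ∷ as) =
  trans (cong (toggle (j , a)) (toggleColumns-unflanked rc unflanked cb cf as))
        (toggle-accepts (j , a) X (rowsClosed⇒intervalClosed
          (rowsClosed-changeRow rc (agreeOff-trans (flipAt-agreeOff X) (flipColumns-agreeOff as S))
                               unflanked cb cf)))
  where X = flipColumns j as S

toggleRow-agreeOff : (S : Subset n m) → AgreeOff j (toggleRow j S) S
toggleRow-agreeOff {m = m} S = toggleColumns-agreeOff (allFin m) S

toggleRow-preserves-rowsClosed : (S : Subset n m) → RowsClosed S → RowsClosed (toggleRow j S)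
toggleRow-preserves-rowsClosed {m = m} {j = j} S rc = intervalClosed⇒rowsClosed
  (toggles-preserve-intervalClosed (map (j ,_) (allFin m)) S (rowsClosed⇒intervalClosed rc))

data RowUpdate (j : Fin n) (S : Subset n m) : Set where
  keptFull : NonEmptyBelow (toℕ j) S → NonEmptyFrom (suc (toℕ j)) S →
             RowFull S j → toggleRow j S ≡ S → RowUpdate j S
  complemented : ¬ (NonEmptyBelow (toℕ j) S × NonEmptyFrom (suc (toℕ j)) S) →
                 ClosedBelow (toℕ j) S → ClosedFrom (suc (toℕ j)) S →
                 (∀ b → member (toggleRow j S) j b ≡ not (member S j b)) → RowUpdate j S
  keptEmpty : ¬ (ClosedBelow (toℕ j) S × ClosedFrom (suc (toℕ j)) S) →
              ¬ RowNonEmpty S j → toggleRow j S ≡ S → RowUpdate j S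

rowUpdate : (j : Fin n) (S : Subset n m) → RowsClosed S → RowUpdate j S
rowUpdate {m = m} j S rc
  with nonEmptyBelow? (toℕ j) S ×-dec nonEmptyFrom? (suc (toℕ j)) S
     | closedBelow? (toℕ j) S ×-dec closedFrom? (suc (toℕ j)) S
... | yes (below@(i , i<j , nei) , above@(l , j<l , nel)) | _ =
  keptFull below above (rc i j l i<j j<l nei nel) (toggleColumns-flanked rc below above (allFin m))
... | no unflanked | yes (cb , cf) =
  complemented unflanked cb cf λ b →
    trans (cong (λ X → member X j b) (toggleColumns-unflanked rc unflanked cb cf (allFin m)))
          (member-flipColumns-∈ S (allFin⁺ m) (∈-allFin b))
... | no _ | no unclosed =
  keptEmpty unclosed (unclosed ∘ rowsClosed-nonEmptyRow rc) (toggleColumns-unclosed rc unclosed (allFin m))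

sign : ℕ → ℤ
sign zero    = + 1
sign (suc k) = - sign k

sign-%2 : ∀ k → sign k ≡ sign (k ℕ.% 2)
sign-%2 zero          = refl
sign-%2 (suc zero)    = refl
sign-%2 (suc (suc k)) = trans (ℤP.neg-involutive (sign k)) (sign-%2 k)

SCelem-sign : (i : Fin n) (a : Fin m) → SCelem (i , a) ≡ sign (toℕ i)
SCelem-sign i a with toℕ i ℕ.% 2 | sign-%2 (toℕ i) | m%n<n (toℕ i) 2
... | zero        | eq | _ = sym eq
... | suc zero    | eq | _ = sym eq
... | suc (suc _) | _  | ℕ.s≤s (ℕ.s≤s ())

signPrefix : ℕ → ℤ
signPrefix zero    = + 0
signPrefix (suc k) = signPrefix k ⊕ sign k

signPrefix-even : ∀ q → signPrefix (q ℕ.* 2) ≡ + 0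
signPrefix-even zero    = refl
signPrefix-even (suc q) = begin
  signPrefix (q ℕ.* 2) ⊕ sign (q ℕ.* 2) ⊕ - sign (q ℕ.* 2)  ≡⟨ cancel _ _ ⟩
  signPrefix (q ℕ.* 2)                                     ≡⟨ signPrefix-even q ⟩
  + 0                                                      ∎
  where
  open ≡-Reasoning
  cancel : ∀ p s → p ⊕ s ⊕ - s ≡ p
  cancel = solve-∀

sumℤ-++ : ∀ xs ys → sumℤ (xs ++ ys) ≡ sumℤ xs ⊕ sumℤ ys
sumℤ-++ []       ys = sym (ℤP.+-identityˡ (sumℤ ys))
sumℤ-++ (x ∷ xs) ys = trans (cong (x ⊕_) (sumℤ-++ xs ys)) (sym (ℤP.+-assoc x (sumℤ xs) (sumℤ ys)))

sumℤ-map-concatMap : ∀ {A B : Set} (h : B → ℤ) (g : A → List B) xs →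
  sumℤ (map h (concatMap g xs)) ≡ sumℤ (map (λ x → sumℤ (map h (g x))) xs)
sumℤ-map-concatMap h g []       = refl
sumℤ-map-concatMap h g (x ∷ xs) = begin
  sumℤ (map h (g x ++ concatMap g xs))                 ≡⟨ cong sumℤ (ListP.map-++ h (g x) (concatMap g xs)) ⟩
  sumℤ (map h (g x) ++ map h (concatMap g xs))         ≡⟨ sumℤ-++ (map h (g x)) (map h (concatMap g xs)) ⟩
  sumℤ (map h (g x)) ⊕ sumℤ (map h (concatMap g xs))   ≡⟨ cong (sumℤ (map h (g x)) ⊕_) (sumℤ-map-concatMap h g xs) ⟩
  sumℤ (map h (g x)) ⊕ sumℤ (map (λ x → sumℤ (map h (g x))) xs) ∎
  where open ≡-Reasoning

sumℤ-map-⊕ : ∀ {A : Set} (f g : A → ℤ) xs →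
  sumℤ (map (λ x → f x ⊕ g x) xs) ≡ sumℤ (map f xs) ⊕ sumℤ (map g xs)
sumℤ-map-⊕ f g []       = refl
sumℤ-map-⊕ f g (x ∷ xs) =
  trans (cong (f x ⊕ g x ⊕_) (sumℤ-map-⊕ f g xs)) (interchange (f x) (g x) (sumℤ (map f xs)) (sumℤ (map g xs)))
  where
  interchange : ∀ a b c d → a ⊕ b ⊕ (c ⊕ d) ≡ a ⊕ c ⊕ (b ⊕ d)
  interchange = solve-∀

sumℤ-map-const : ∀ {A : Set} c (xs : List A) → sumℤ (map (λ _ → c) xs) ≡ sumℤ (map (λ _ → + 1) xs) * c
sumℤ-map-const c []       = refl
sumℤ-map-const c (x ∷ xs) = begin
  c ⊕ sumℤ (map (λ _ → c) xs)                 ≡⟨ cong (c ⊕_) (sumℤ-map-const c xs) ⟩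
  c ⊕ sumℤ (map (λ _ → + 1) xs) * c           ≡⟨ distrib c (sumℤ (map (λ _ → + 1) xs)) ⟩
  (+ 1 ⊕ sumℤ (map (λ _ → + 1) xs)) * c       ∎
  where
  open ≡-Reasoning
  distrib : ∀ c s → c ⊕ s * c ≡ (+ 1 ⊕ s) * c
  distrib = solve-∀

columns : ℕ → ℤ
columns m = sumℤ (map (λ (_ : Fin m) → + 1) (allFin m))

rowSC : Subset n m → Fin n → ℤ
rowSC {m = m} S i = sumℤ (map (λ a → if member S i a then SCelem (i , a) else + 0) (allFin m))

opaque
  unfolding member

  SC-rows : (S : Subset n m) → SC S ≡ sumℤ (map (rowSC S) (allFin n))
  SC-rows {n} {m} S =
    trans (sumℤ-map-concatMap _ (λ i → map (i ,_) (allFin m)) (allFin n))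
          (cong sumℤ (ListP.map-cong (λ i → cong sumℤ (sym (ListP.map-∘ (allFin m)))) (allFin n)))

  rowSC-cong : ∀ {n m} {T S : Subset n m} {i} → lookup T i ≡ lookup S i → rowSC T i ≡ rowSC S i
  rowSC-cong {m = m} {i = i} eq =
    cong sumℤ (ListP.map-cong (λ a → cong (λ row → if lookup row a then SCelem (i , a) else + 0) eq) (allFin m))

SCelem-rowSum : (i : Fin n) →
  sumℤ (map (λ a → SCelem (i , a)) (allFin m)) ≡ columns m * sign (toℕ i)
SCelem-rowSum {m = m} i =
  trans (cong sumℤ (ListP.map-cong (SCelem-sign i) (allFin m))) (sumℤ-map-const (sign (toℕ i)) (allFin m))

rowSC-members : (S : Subset n m) (i : Fin n) (bs : Fin m → Bool) → (∀ a → member S i a ≡ bs a) →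
  rowSC S i ≡ sumℤ (map (λ a → if bs a then SCelem (i , a) else + 0) (allFin m))
rowSC-members {m = m} S i bs eq =
  cong sumℤ (ListP.map-cong (λ a → cong (λ x → if x then SCelem (i , a) else + 0) (eq a)) (allFin m))

rowSC-full : (S : Subset n m) → RowFull S i → rowSC S i ≡ columns m * sign (toℕ i)
rowSC-full {m = m} {i = i} S full = trans (rowSC-members S i (λ _ → true) full) (SCelem-rowSum {m = m} i)

rowSC-empty : (S : Subset n m) → ¬ RowNonEmpty S i → rowSC S i ≡ + 0
rowSC-empty {m = m} {i = i} S empty = begin
  rowSC S i                           ≡⟨ rowSC-members S i (λ _ → false) (λ _ → ¬rowNonEmpty⇒false {S = S} {i} empty) ⟩
  sumℤ (map (λ _ → + 0) (allFin m))   ≡⟨ sumℤ-map-const (+ 0) (allFin m) ⟩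
  columns m * + 0                     ≡⟨ ℤP.*-zeroʳ (columns m) ⟩
  + 0                                 ∎
  where open ≡-Reasoning

rowSC-complement : (S T : Subset n m) → (∀ a → member T i a ≡ not (member S i a)) →
  rowSC S i ⊕ rowSC T i ≡ columns m * sign (toℕ i)
rowSC-complement {m = m} {i = i} S T comp = begin
  rowSC S i ⊕ rowSC T i                             ≡⟨ sumℤ-map-⊕ (term S) (term T) (allFin m) ⟨
  sumℤ (map (λ a → term S a ⊕ term T a) (allFin m)) ≡⟨ cong sumℤ (ListP.map-cong pointwise (allFin m)) ⟩
  sumℤ (map (λ a → SCelem (i , a)) (allFin m))      ≡⟨ SCelem-rowSum {m = m} i ⟩
  columns m * sign (toℕ i)                          ∎
  where
  open ≡-Reasoning
  term : Subset _ _ → Fin _ → ℤ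
  term X a = if member X i a then SCelem (i , a) else + 0
  pointwise : ∀ a → term S a ⊕ term T a ≡ SCelem (i , a)
  pointwise a rewrite comp a with member S i a
  ... | true  = ℤP.+-identityʳ (SCelem (i , a))
  ... | false = ℤP.+-identityˡ (SCelem (i , a))

rowGain : RowUpdate j S → ℤ
rowGain {j = j} (keptFull _ _ _ _)     = sign (toℕ j) ⊕ sign (toℕ j)
rowGain {j = j} (complemented _ _ _ _) = sign (toℕ j)
rowGain         (keptEmpty _ _ _)      = + 0

rowSC-toggleRow : ∀ {n m} {j : Fin n} {S : Subset n m} (u : RowUpdate j S) →
                  rowSC S j ⊕ rowSC (toggleRow j S) j ≡ columns m * rowGain u
rowSC-toggleRow {m = m} {j} {S} (keptFull _ _ full eq) = begin
  rowSC S j ⊕ rowSC (toggleRow j S) j                  ≡⟨ cong (λ X → rowSC S j ⊕ rowSC X j) eq ⟩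
  rowSC S j ⊕ rowSC S j                                ≡⟨ cong₂ _⊕_ (rowSC-full S full) (rowSC-full S full) ⟩
  columns m * sign (toℕ j) ⊕ columns m * sign (toℕ j)  ≡⟨ ℤP.*-distribˡ-+ (columns m) _ _ ⟨
  columns m * (sign (toℕ j) ⊕ sign (toℕ j))            ∎
  where open ≡-Reasoning
rowSC-toggleRow {S = S} (complemented _ _ _ comp) = rowSC-complement S (toggleRow _ S) comp
rowSC-toggleRow {m = m} {j} {S} (keptEmpty _ empty eq) = begin
  rowSC S j ⊕ rowSC (toggleRow j S) j    ≡⟨ cong (λ X → rowSC S j ⊕ rowSC X j) eq ⟩
  rowSC S j ⊕ rowSC S j                  ≡⟨ cong₂ _⊕_ (rowSC-empty S empty) (rowSC-empty S empty) ⟩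
  + 0                                    ≡⟨ ℤP.*-zeroʳ (columns m) ⟨
  columns m * + 0                        ∎
  where open ≡-Reasoning

-- For even n, - signPrefix d is the sum of sign i over d ≤ i < n.
data Weight (d : ℕ) (S : Subset n m) : ℤ → Set where
  straddling : NonEmptyBelow d S → NonEmptyFrom d S → Weight d S (sign d)
  closedCut  : ¬ (NonEmptyBelow d S × NonEmptyFrom d S) →
               ClosedBelow d S → ClosedFrom d S → Weight d S (- signPrefix d)
  openCut    : ¬ (ClosedBelow d S × ClosedFrom d S) → Weight d S (+ 0)

weight-cast : ∀ {w w′} → w ≡ w′ → Weight d S w → Weight d S w′
weight-cast {d = d} {S = S} = subst (Weight d S)

weight-bottom : Weight 0 S w → w ≡ + 0
weight-bottom (straddling (_ , () , _) _)
weight-bottom (closedCut _ _ _) = refl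
weight-bottom (openCut _)       = refl

¬closedBelow-suc : ClosedBelow (toℕ j) S → ¬ ClosedBelow (suc (toℕ j)) S →
                   NonEmptyBelow (toℕ j) S × ¬ RowFull S j
¬closedBelow-suc {j = j} {S = S} cb ¬cb⁺ with nonEmptyBelow? (toℕ j) S | rowFull? S j
... | yes below | no ¬full = below , ¬full
... | yes _     | yes full = contradiction (closedBelow-suc⁺ cb λ _ → full) ¬cb⁺
... | no ¬below | _        = contradiction (closedBelow-suc⁺ cb λ below → contradiction below ¬below) ¬cb⁺

module _ {S : Subset n m} {j : Fin n} (rc : RowsClosed S) where

  weight-keptFull : NonEmptyBelow (toℕ j) S → NonEmptyFrom (suc (toℕ j)) S →
                    Weight (suc (toℕ j)) S w → Weight (toℕ j) S (w ⊕ (sign (toℕ j) ⊕ sign (toℕ j)))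
  weight-keptFull below above (straddling _ _) =
    weight-cast (again (sign (toℕ j))) (straddling below (nonEmptyFrom-suc⁺ above))
    where
    again : ∀ s → s ≡ - s ⊕ (s ⊕ s)
    again = solve-∀
  weight-keptFull below above (closedCut unstraddled _ _) =
    contradiction (nonEmptyBelow-suc⁺ below , above) unstraddled
  weight-keptFull below above (openCut unclosed) =
    contradiction (rowsClosed-closedBelow rc above , rowsClosed-closedFrom rc (nonEmptyBelow-suc⁺ below)) unclosed

  weight-keptEmpty : ¬ (ClosedBelow (toℕ j) S × ClosedFrom (suc (toℕ j)) S) →
                     Weight (suc (toℕ j)) S w → Weight (toℕ j) S (w ⊕ + 0)
  weight-keptEmpty unclosed (straddling below above) =
    contradiction (rowsClosed-closedBelow rc (nonEmptyFrom-suc⁺ above) , rowsClosed-closedFrom rc below) unclosed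
  weight-keptEmpty unclosed (closedCut _ cb cf) = contradiction (closedBelow-suc⁻ cb , cf) unclosed
  weight-keptEmpty unclosed (openCut _) = openCut λ (cb , cf) → unclosed (cb , closedFrom-suc⁻ cf)

  module _ (unflanked : ¬ (NonEmptyBelow (toℕ j) S × NonEmptyFrom (suc (toℕ j)) S))
           (cb : ClosedBelow (toℕ j) S) (cf : ClosedFrom (suc (toℕ j)) S)
           (comp : ∀ b → member (toggleRow j S) j b ≡ not (member S j b)) where

    private
      o : AgreeOff j (toggleRow j S) S
      o = toggleRow-agreeOff S

      o⁻ : AgreeOff j S (toggleRow j S)
      o⁻ = agreeOff-sym o

      full-if-empty : ¬ RowNonEmpty S j → RowFull (toggleRow j S) j
      full-if-empty empty b = trans (comp b) (cong not (¬rowNonEmpty⇒false {S = S} {j} empty))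

      nonFull-if-nonEmpty : RowNonEmpty S j → ¬ RowFull (toggleRow j S) j
      nonFull-if-nonEmpty (a , a∈) full =
        contradiction (trans (sym (full a)) (trans (comp a) (cong not a∈))) λ ()

      nonFull-if-nonEmpty′ : RowNonEmpty (toggleRow j S) j → ¬ RowFull S j
      nonFull-if-nonEmpty′ (a , a∈) full =
        contradiction (trans (sym a∈) (trans (comp a) (cong not (full a)))) λ ()

      nonEmpty-if-nonFull : ¬ RowFull S j → RowNonEmpty (toggleRow j S) j
      nonEmpty-if-nonFull ¬full with rowNonEmpty? (toggleRow j S) j
      ... | yes ne   = ne
      ... | no empty = contradiction was-full ¬full
        where
        was-full : RowFull S j
        was-full a = begin
          member S j a                      ≡⟨ BoolP.not-involutive (member S j a) ⟨
          not (not (member S j a))          ≡⟨ cong not (comp a) ⟨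
          not (member (toggleRow j S) j a)  ≡⟨ cong not (¬rowNonEmpty⇒false {S = toggleRow j S} {j} empty) ⟩
          true                              ∎
          where open ≡-Reasoning

    weight-complemented : Weight (suc (toℕ j)) S w → Weight (toℕ j) (toggleRow j S) (w ⊕ sign (toℕ j))
    weight-complemented (straddling below⁺ above) with nonEmptyBelow-suc⁻ below⁺
    ... | inj₁ below = contradiction (below , above) unflanked
    ... | inj₂ ne    = weight-cast (sym (ℤP.+-inverseˡ (sign (toℕ j))))
      (openCut λ (_ , cfT) → nonFull-if-nonEmpty ne (closedFrom-row cfT (agreeOff-nonEmptyFrom o above)))
    weight-complemented (closedCut unstraddled cb⁺ cf⁺) =
      weight-cast (shift _ _) (closedCut unstraddledT (agreeOff-closedBelow o cb) cfT)
      where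
      shift : ∀ p s → - p ≡ - (p ⊕ s) ⊕ s
      shift = solve-∀
      unstraddledT : ¬ (NonEmptyBelow (toℕ j) (toggleRow j S) × NonEmptyFrom (toℕ j) (toggleRow j S))
      unstraddledT (belowT , aboveT) with agreeOff-nonEmptyBelow o⁻ belowT | nonEmptyFrom-suc⁻ aboveT
      ... | below | inj₁ above = unstraddled (nonEmptyBelow-suc⁺ below , agreeOff-nonEmptyFrom o⁻ above)
      ... | below | inj₂ neT   = nonFull-if-nonEmpty′ neT (closedBelow-row cb⁺ below)
      cfT : ClosedFrom (toℕ j) (toggleRow j S)
      cfT = closedFrom-suc⁺ (agreeOff-closedFrom o cf⁺) λ aboveT →
        full-if-empty λ ne → unstraddled (nonEmptyBelow-row ne , agreeOff-nonEmptyFrom o⁻ aboveT)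
    weight-complemented (openCut unclosed⁺) with ¬closedBelow-suc cb (λ cb⁺ → unclosed⁺ (cb⁺ , cf))
    ... | below , ¬full = weight-cast (sym (ℤP.+-identityˡ (sign (toℕ j))))
      (straddling (agreeOff-nonEmptyBelow o below) (nonEmptyFrom-row (nonEmpty-if-nonFull ¬full)))

  weight-step : (u : RowUpdate j S) →
                Weight (suc (toℕ j)) S w → Weight (toℕ j) (toggleRow j S) (w ⊕ rowGain u)
  weight-step (keptFull below above _ eq) W =
    subst (λ X → Weight (toℕ j) X _) (sym eq) (weight-keptFull below above W)
  weight-step (complemented unflanked cb cf comp) W = weight-complemented unflanked cb cf comp W
  weight-step (keptEmpty unclosed _ eq) W =
    subst (λ X → Weight (toℕ j) X _) (sym eq) (weight-keptEmpty unclosed W)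

-- Scanning the rows from the top down

record Scan (I : Subset n m) (d : ℕ) (rows : List (Fin n)) (V : Subset n m) : Set where
  field
    rowsClosed : RowsClosed V
    agreeBelow : ∀ i → toℕ i < d → lookup V i ≡ lookup I i
    weight     : ℤ
    hasWeight  : Weight d V weight
    total      : sumℤ (map (λ i → rowSC I i ⊕ rowSC V i) rows) ≡ columns m * weight
open Scan

scan-start : ∀ {n m} (I : Subset n m) → signPrefix n ≡ + 0 → RowsClosed I → Scan I n [] I
scan-start {n} {m} I even rc = record
  { rowsClosed = rc
  ; agreeBelow = λ _ _ → refl
  ; weight     = + 0
  ; hasWeight  = weight-top
  ; total      = sym (ℤP.*-zeroʳ (columns m))
  }
  where
  weight-top : Weight n I (+ 0)
  weight-top with closedBelow? n I
  ... | yes cb = weight-cast (cong -_ even)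
                   (closedCut (λ (_ , l , n≤l , _) → ℕP.<⇒≱ (FinP.toℕ<n l) n≤l) cb
                              (λ k _ n≤k → contradiction n≤k (ℕP.<⇒≱ (FinP.toℕ<n k))))
  ... | no ¬cb = openCut λ (cb , _) → ¬cb cb

scan-step : ∀ {n m} {j : Fin n} {d rows} {I V : Subset n m} → toℕ j ≡ d → All (λ i → d < toℕ i) rows →
            Scan I (suc d) rows V → Scan I d (j ∷ rows) (toggleRow j V)
scan-step {m = m} {j = j} {rows = rows} {I = I} {V = V} refl above sc = record
  { rowsClosed = toggleRow-preserves-rowsClosed V (rowsClosed sc)
  ; agreeBelow = λ i i<j →
      trans (AgreeOff.rowEq o i (FinP.<⇒≢ i<j)) (agreeBelow sc i (ℕP.m<n⇒m<1+n i<j))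
  ; weight     = weight sc ⊕ rowGain u
  ; hasWeight  = weight-step (rowsClosed sc) u (hasWeight sc)
  ; total      = total′
  }
  where
  o = toggleRow-agreeOff {j = j} V
  u = rowUpdate j V (rowsClosed sc)
  V′ = toggleRow j V
  M = columns m
  rowJ : rowSC I j ≡ rowSC V j
  rowJ = rowSC-cong (sym (agreeBelow sc j (ℕP.n<1+n (toℕ j))))
  untouched : sumℤ (map (λ i → rowSC I i ⊕ rowSC V′ i) rows) ≡
              sumℤ (map (λ i → rowSC I i ⊕ rowSC V i) rows)
  untouched = cong sumℤ (ListP.map-cong-local
    (All.map (λ {i} j<i → cong (rowSC I i ⊕_) (rowSC-cong (AgreeOff.rowEq o i (>⇒≢ j<i)))) above))
  regroup : ∀ M g w → M * g ⊕ M * w ≡ M * (w ⊕ g)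
  regroup = solve-∀
  total′ : rowSC I j ⊕ rowSC V′ j ⊕ sumℤ (map (λ i → rowSC I i ⊕ rowSC V′ i) rows) ≡
           M * (weight sc ⊕ rowGain u)
  total′ = begin
    rowSC I j ⊕ rowSC V′ j ⊕ sumℤ (map (λ i → rowSC I i ⊕ rowSC V′ i) rows)
      ≡⟨ cong₂ _⊕_ (cong (_⊕ rowSC V′ j) rowJ) untouched ⟩
    rowSC V j ⊕ rowSC V′ j ⊕ sumℤ (map (λ i → rowSC I i ⊕ rowSC V i) rows)
      ≡⟨ cong₂ _⊕_ (rowSC-toggleRow u) (total sc) ⟩
    M * rowGain u ⊕ M * weight sc
      ≡⟨ regroup M (rowGain u) (weight sc) ⟩
    M * (weight sc ⊕ rowGain u) ∎
    where open ≡-Reasoning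

scan : ∀ {n m} (I : Subset n m) → signPrefix n ≡ + 0 → RowsClosed I →
       ∀ k d (f : Fin k → Fin n) → (∀ x → toℕ (f x) ≡ d ℕ.+ toℕ x) → d ℕ.+ k ≡ n →
       Scan I d (tabulate f) (foldr toggleRow I (tabulate f))
scan I even rc zero    d f f-from-d d≡n =
  subst (λ e → Scan I e [] I) (trans (sym d≡n) (ℕP.+-identityʳ d)) (scan-start I even rc)
scan I even rc (suc k) d f f-from-d d+k≡n =
  scan-step (trans (f-from-d F.zero) (ℕP.+-identityʳ d))
            (tabulate⁺ λ x → subst (d <_) (sym (f-from-d (F.suc x))) (ℕP.m<m+n d ℕ.z<s))
            (scan I even rc k (suc d) (f ∘ F.suc)
                  (λ x → trans (f-from-d (F.suc x)) (ℕP.+-suc d (toℕ x)))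
                  (trans (sym (ℕP.+-suc d k)) d+k≡n))

scan-end : ∀ {n m} {I V : Subset n m} → Scan I 0 (allFin n) V → SC I ⊕ SC V ≡ + 0
scan-end {n} {m} {I} {V} sc = begin
  SC I ⊕ SC V                                                ≡⟨ cong₂ _⊕_ (SC-rows I) (SC-rows V) ⟩
  sumℤ (map (rowSC I) (allFin n)) ⊕ sumℤ (map (rowSC V) (allFin n))
                                                             ≡⟨ sumℤ-map-⊕ (rowSC I) (rowSC V) (allFin n) ⟨
  sumℤ (map (λ i → rowSC I i ⊕ rowSC V i) (allFin n))        ≡⟨ total sc ⟩
  columns m * weight sc                                      ≡⟨ cong (columns m *_) (weight-bottom (hasWeight sc)) ⟩
  columns m * + 0                                            ≡⟨ ℤP.*-zeroʳ (columns m) ⟩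
  + 0                                                        ∎
  where open ≡-Reasoning

foldr-concatMap : ∀ {A B C : Set} (f : A → B → B) (z : B) (g : C → List A) xs →
  foldr f z (concatMap g xs) ≡ foldr (λ x acc → foldr f acc (g x)) z xs
foldr-concatMap f z g []       = refl
foldr-concatMap f z g (x ∷ xs) =
  trans (ListP.foldr-++ f z (g x) (concatMap g xs)) (cong (λ acc → foldr f acc (g x)) (foldr-concatMap f z g xs))

rowmotion-toggleRows : (I : Subset n m) → rowmotion I ≡ foldr toggleRow I (allFin n)
rowmotion-toggleRows {n} {m} I = foldr-concatMap toggle I (λ i → map (i ,_) (allFin m)) (allFin n)

SC-rowmotion : signPrefix n ≡ + 0 → (I : Subset n m) → IntervalClosed I → SC (rowmotion I) ≡ - SC I
SC-rowmotion {n} even I ic = inverseʳ-unique (SC I) (SC (rowmotion I)) (begin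
  SC I ⊕ SC (rowmotion I)                   ≡⟨ cong (λ R → SC I ⊕ SC R) (rowmotion-toggleRows I) ⟩
  SC I ⊕ SC (foldr toggleRow I (allFin n))  ≡⟨ scan-end fullScan ⟩
  + 0                                       ∎)
  where
  open ≡-Reasoning
  fullScan = scan I even (intervalClosed⇒rowsClosed ic) n 0 id (λ _ → refl) refl

sumℤ-applyUpTo-suc : ∀ (g : ℕ → ℤ) p → sumℤ (applyUpTo g (suc p)) ≡ sumℤ (applyUpTo g p) ⊕ g p
sumℤ-applyUpTo-suc g zero    = ℤP.+-comm (g 0) (+ 0)
sumℤ-applyUpTo-suc g (suc p) =
  trans (cong (g 0 ⊕_) (sumℤ-applyUpTo-suc (g ∘ suc) p))
        (sym (ℤP.+-assoc (g 0) (sumℤ (applyUpTo (g ∘ suc) p)) (g (suc p))))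

sumℤ-applyUpTo-antishift : ∀ (g : ℕ → ℤ) → (∀ k → g (suc k) ≡ - g k) →
  ∀ p → sumℤ (applyUpTo (g ∘ suc) p) ≡ - sumℤ (applyUpTo g p)
sumℤ-applyUpTo-antishift g anti zero    = refl
sumℤ-applyUpTo-antishift g anti (suc p) =
  trans (cong₂ _⊕_ (anti 0) (sumℤ-applyUpTo-antishift (g ∘ suc) (anti ∘ suc) p))
        (sym (ℤP.neg-distrib-+ (g 0) (sumℤ (applyUpTo (g ∘ suc) p))))

self-negation-zero : ∀ x → - x ≡ x → x ≡ + 0
self-negation-zero (+ zero)  _ = refl
self-negation-zero (+ suc _) ()
self-negation-zero -[1+ _ ] ()

-- The window shifted by one step sums to - S by antiperiodicity and to S by periodicity.
sumℤ-antiperiodic : ∀ (g : ℕ → ℤ) p → (∀ k → g (suc k) ≡ - g k) → g p ≡ g 0 →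
                    sumℤ (applyUpTo g p) ≡ + 0
sumℤ-antiperiodic g p anti periodic = self-negation-zero Σg (∙-cancelˡ (g 0) (- Σg) Σg (begin
  g 0 ⊕ - Σg                              ≡⟨ cong (g 0 ⊕_) (sumℤ-applyUpTo-antishift g anti p) ⟨
  g 0 ⊕ sumℤ (applyUpTo (g ∘ suc) p)     ≡⟨ sumℤ-applyUpTo-suc g p ⟩
  Σg ⊕ g p                                ≡⟨ cong (Σg ⊕_) periodic ⟩
  Σg ⊕ g 0                                ≡⟨ ℤP.+-comm Σg (g 0) ⟩
  g 0 ⊕ Σg                                ∎))
  where
  Σg = sumℤ (applyUpTo g p)
  open ≡-Reasoning

iterate-intervalClosed : (I : Subset n m) → IntervalClosed I → ∀ k → IntervalClosed (iter k rowmotion I)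
iterate-intervalClosed I ic zero    = ic
iterate-intervalClosed {n} {m} I ic (suc k) =
  toggles-preserve-intervalClosed (linExt n m) (iter k rowmotion I) (iterate-intervalClosed I ic k)

theorem3p21 : (n m : ℕ) → 2 ∣ n → 1 ≤ m →
    (I : Subset n m) → IntervalClosed I →
    (p : ℕ) → 1 ≤ p → iter p rowmotion I ≡ I →
    (∀ q → 1 ≤ q → q < p → iter q rowmotion I ≢ I) →
    orbitSum p I ≡ + 0
theorem3p21 n m (divides q refl) _ I ic p _ periodic _ = begin
  orbitSum p I                   ≡⟨ cong sumℤ (ListP.map-upTo g p) ⟩
  sumℤ (applyUpTo g p)           ≡⟨ sumℤ-antiperiodic g p antiperiodic (cong SC periodic) ⟩
  + 0                            ∎
  where
  open ≡-Reasoning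
  g : ℕ → ℤ
  g k = SC (iter k rowmotion I)
  antiperiodic : ∀ k → g (suc k) ≡ - g k
  antiperiodic k = SC-rowmotion (signPrefix-even q) (iter k rowmotion I)
    (iterate-intervalClosed I ic k)
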